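{- Let $k\ge 1$ and $n=2k+1$, with all notation as in the context. Then: (a) for every skew edge of $M_k/\pi$ joining a vertex $u\in L_k/\pi$ to a vertex $w\in L_{k+1}/\pi$, there is also a skew edge of $M_k/\pi$ joining $\aleph_\pi^{ -1}(w)\in L_k/\pi$ to $\aleph_\pi(u)\in L_{k+1}/\pi$; (i) for every skew edge $\{B,B'\}$ of $M_k$ with $B\in L_k$, $B'\in L_{k+1}$, the pair $\{\aleph^{ -1}(B'),\aleph(B)\}$ is also a skew edge of $M_k$ (distinct from $\{B,B'\}$), so the skew edges of $M_k$ come in pairs $\{B,B'\},\{\aleph^{ -1}(B'),\aleph(B)\}$ whose end-vertices form the two "horizontal" pairs $(B,\aleph(B))$ and $(\aleph^{ -1}(B'),B')$; (ii) for every $u\in L_k/\pi$, the number of (horizontal) edges of $M_k/\pi$ joining $u$ and $\aleph_\pi(u)$ is at most $2$.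
   Context: Let $k\ge1$ and $n=2k+1$. Identify subsets $A\subseteq\{0,\dots,n-1\}$ with their characteristic binary strings $b_0b_1\dots b_{n-1}$ ($b_i=1$ iff $i\in A$). For $0\le j\le n$, $L_j$ is the set of subsets of size $j$. The middle-levels graph $M_k$ has vertex set $L_k\cup L_{k+1}$, with $A\in L_k$ adjacent to $A'\in L_{k+1}$ iff $A\subset A'$. Let $\pi$ be the equivalence relation on $L_k\cup L_{k+1}$ identifying two sets iff one is a cyclic translate of the other modulo $n$ (equivalently $\beta_{A'}(x)\equiv x^i\beta_A(x)\pmod{1+x^n}$ for some $i$, where $\beta_A(x)=\sum b_ix^i$); $L_j/\pi$ denotes the set of classes. The quotient multigraph $M_k/\pi$ has vertex set $L_k/\pi\cup L_{k+1}/\pi$ and its edges are the orbits of edges of $M_k$ under cyclic translation; thus the number of edges between $u\in L_k/\pi$ and $w\in L_{k+1}/\pi$ equals the number of $i\notin A$ with $A\cup\{i\}\in w$, for any fixed $A\in u$. Let $\aleph:L_k\to L_{k+1}$ be the bijection $\aleph(b_0b_1\dots b_{n-1})=\bar b_{n-1}\dots\bar b_1\bar b_0$ (complement and reverse, $\bar0=1,\bar1=0$); the same formula gives its inverse $L_{k+1}\to L_k$. It commutes with translation and induces a bijection $\aleph_\pi:L_k/\pi\to L_{k+1}/\pi$. An edge $\{B,B'\}$ of $M_k$ ($B\in L_k$) is horizontal if $B'=\aleph(B)$ and skew otherwise; an edge of $M_k/\pi$ between $u$ and $w$ is horizontal if $w=\aleph_\pi(u)$ and skew otherwise. -}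

module Defs where

open import Data.Nat using (ℕ; zero; suc)
open import Data.Bool using (Bool)
open import Data.Bool.Properties using () renaming (_≟_ to _≟ᵇ_)
open import Data.Fin using (Fin; toℕ)
open import Data.Fin.Subset using (Subset; ∣_∣; _⊆_; _∉_; _∪_; ⁅_⁆; ∁)
open import Data.Fin.Subset.Properties using (_∈?_)
open import Data.Fin.Properties using (any?)
open import Data.Vec using (Vec; []; _∷_; _∷ʳ_; reverse)
open import Data.Vec.Properties using (≡-dec)
open import Data.Product using (Σ; ∃; _×_; _,_)
open import Data.List using (List; filter; length)
open import Relation.Nullary using (Dec; ¬_)

open import Relation.Nullary.Decidable using (_×-dec_; ¬?)
open import Relation.Binary.PropositionalEquality using (_≡_)
import Data.List as L
open import Data.Fin using () renaming (zero to fzero)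

-- Subsets of {0,…,n-1} are identified with characteristic strings b₀…b_{n-1}
-- (Data.Fin.Subset n = Vec Bool n, position i ↦ b_i).

InLevel : ∀ {n} → ℕ → Subset n → Set
InLevel j A = ∣ A ∣ ≡ j

rot : ∀ {n} → Subset n → Subset n
rot []       = []
rot (x ∷ xs) = xs ∷ʳ x

shift : ∀ {n} → ℕ → Subset n → Subset n
shift zero    A = A
shift (suc i) A = rot (shift i A)

_∼π_ : ∀ {n} → Subset n → Subset n → Set
_∼π_ {n} A A' = Σ (Fin n) λ i → shift (toℕ i) A ≡ A'

_∼π?_ : ∀ {n} (A A' : Subset n) → Dec (A ∼π A')
A ∼π? A' = any? (λ i → ≡-dec _≟ᵇ_ (shift (toℕ i) A) A')

Edge : ∀ {n} → ℕ → Subset n → Subset n → Set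
Edge k A A' = InLevel k A × InLevel (suc k) A' × A ⊆ A'

-- ℵ(b₀…b_{n-1}) = b̄_{n-1}…b̄₀  (complement and reverse); it is an involution,
-- so ℵ⁻¹ is given by the same formula.
ℵ : ∀ {n} → Subset n → Subset n
ℵ A = reverse (∁ A)

ℵ⁻¹ : ∀ {n} → Subset n → Subset n
ℵ⁻¹ A = reverse (∁ A)

SkewEdge : ∀ {n} → ℕ → Subset n → Subset n → Set
SkewEdge k B B' = Edge k B B' × ¬ (B' ≡ ℵ B)

QSkewEdge : ∀ {n} → ℕ → Subset n → Subset n → Set
QSkewEdge {n} k A A' =
  Σ (Subset n) λ C → Σ (Subset n) λ C' →
    C ∼π A × C' ∼π A' × Edge k C C' × ¬ (A' ∼π ℵ A)

qEdgeCount : ∀ {n} → Subset n → Subset n → ℕ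
qEdgeCount {n} A A' =
  length (filter (λ i → ¬? (i ∈? A) ×-dec ((A ∪ ⁅ i ⁆) ∼π? A')) (L.allFin n))

-- Parts (a) and (i) rest on three elementary properties of ℵ = reverse ∘ complement,
-- proved first for strings of any length: it is an involution, it reverses
-- inclusion and sends level j to level n ∸ j (so for n = 2k+1 it turns an edge
-- C ⊂ C' into the edge ℵ C' ⊂ ℵ C), and it conjugates translation by t into
-- translation by -t (so it respects π).
--
-- For the latter and for part (ii), module Cyclic reads a string of length n as an
-- n-periodic function on ℤ; ℵ becomes z ↦ ¬A(-1-z). A horizontal edge of M_k/π at
-- a position i ∉ A says that A is anti-symmetric about i: A(y) = ¬A(2i-y) for all
-- y ≢ i (mod n). Composing reflections about two such centres translates by twice
-- their distance, which is non-zero because n is odd; a short chase of reflections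
-- then shows that no string has three centres, so the list counted by qEdgeCount
-- has at most two entries.
module Submission where

open import Defs
open import Data.Bool using (Bool; true; false; not; _∨_)
import Data.Bool.Properties as BoolP
open import Data.Empty using (⊥; ⊥-elim)
open import Data.Fin as Fin using (Fin; toℕ; fromℕ; fromℕ<; inject₁; lower₁; opposite)
import Data.Fin.Properties as FinP
open import Data.Fin.Subset using (Subset; ∣_∣; ∁; _∪_; ⁅_⁆; _⊆_; _∉_)
open import Data.Fin.Subset.Properties using (_∈?_; ∣∁p∣≡n∸∣p∣; x∈⁅x⁆; x∈⁅y⁆⇒x≡y)
open import Data.List using (List; []; _∷_; length; allFin)
open import Data.List.Relation.Unary.All using (All; []; _∷_)
open import Data.List.Relation.Unary.All.Properties using (all-filter)
open import Data.List.Relation.Unary.AllPairs using (_∷_)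
open import Data.List.Relation.Unary.Unique.Propositional using (Unique)
open import Data.List.Relation.Unary.Unique.Propositional.Properties using (allFin⁺; filter⁺)
import Data.Nat as ℕ
open ℕ using (ℕ; zero; suc; _∸_; _≤_; z≤n; s≤s)
import Data.Nat.Divisibility as ℕD
import Data.Nat.Properties as ℕP
open import Data.Product using (Σ; _×_; _,_; proj₁)
open import Data.Sum using (_⊎_; inj₁; inj₂)
open import Data.Vec using (Vec; []; _∷_; _∷ʳ_; reverse; lookup)
import Data.Vec.Properties as VecP
open import Relation.Nullary using (¬_; Dec; yes; no)
open import Relation.Nullary.Decidable using (_×-dec_; ¬?)
open import Relation.Binary.PropositionalEquality
open ≡-Reasoning

not-swap : ∀ {a b : Bool} → a ≡ not b → b ≡ not a
not-swap {b = b} refl = sym (BoolP.not-involutive b)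

true≢false : true ≢ false
true≢false ()

last-or-inject₁ : ∀ {m} (j : Fin (suc m)) → j ≡ fromℕ m ⊎ Σ (Fin m) (λ j' → j ≡ inject₁ j')
last-or-inject₁ {m} j with m ℕ.≟ toℕ j
... | yes m≡j = inj₁ (FinP.toℕ-injective (trans (sym m≡j) (sym (FinP.toℕ-fromℕ m))))
... | no m≢j  = inj₂ (lower₁ j m≢j , sym (FinP.inject₁-lower₁ j m≢j))

module _ {A : Set} where

  lookup-∷ʳ-fromℕ : ∀ {m} (xs : Vec A m) x → lookup (xs ∷ʳ x) (fromℕ m) ≡ x
  lookup-∷ʳ-fromℕ []       x = refl
  lookup-∷ʳ-fromℕ (_ ∷ xs) x = lookup-∷ʳ-fromℕ xs x

  lookup-∷ʳ-inject₁ : ∀ {m} (xs : Vec A m) x j → lookup (xs ∷ʳ x) (inject₁ j) ≡ lookup xs j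
  lookup-∷ʳ-inject₁ (_ ∷ xs) x Fin.zero    = refl
  lookup-∷ʳ-inject₁ (_ ∷ xs) x (Fin.suc j) = lookup-∷ʳ-inject₁ xs x j

  lookup-reverse : ∀ {m} (xs : Vec A m) j → lookup (reverse xs) (opposite j) ≡ lookup xs j
  lookup-reverse (x ∷ xs) Fin.zero    rewrite VecP.reverse-∷ x xs = lookup-∷ʳ-fromℕ (reverse xs) x
  lookup-reverse (x ∷ xs) (Fin.suc j) rewrite VecP.reverse-∷ x xs =
    trans (lookup-∷ʳ-inject₁ (reverse xs) x (opposite j)) (lookup-reverse xs j)

  lookup-ext : ∀ {m} {xs ys : Vec A m} → (∀ j → lookup xs j ≡ lookup ys j) → xs ≡ ys
  lookup-ext {xs = xs} {ys} h =
    trans (sym (VecP.tabulate∘lookup xs)) (trans (VecP.tabulate-cong h) (VecP.tabulate∘lookup ys))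

∉⇒lookup≡false : ∀ {n} {p : Subset n} {x} → x ∉ p → lookup p x ≡ false
∉⇒lookup≡false {p = p} {x} x∉p with lookup p x in eq
... | false = refl
... | true  = ⊥-elim (x∉p (VecP.lookup⇒[]= x p eq))

∣∷ʳ∣ : ∀ {n} (p : Subset n) x → ∣ p ∷ʳ x ∣ ≡ ∣ x ∷ p ∣
∣∷ʳ∣ []           x     = refl
∣∷ʳ∣ (true  ∷ p)  true  = cong suc (∣∷ʳ∣ p true)
∣∷ʳ∣ (true  ∷ p)  false = cong suc (∣∷ʳ∣ p false)
∣∷ʳ∣ (false ∷ p)  true  = ∣∷ʳ∣ p true
∣∷ʳ∣ (false ∷ p)  false = ∣∷ʳ∣ p false

∣reverse∣ : ∀ {n} (p : Subset n) → ∣ reverse p ∣ ≡ ∣ p ∣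
∣reverse∣ []          = refl
∣reverse∣ (x ∷ p) rewrite VecP.reverse-∷ x p = trans (∣∷ʳ∣ (reverse p) x) (cons-cong x)
  where
    cons-cong : ∀ x → ∣ x ∷ reverse p ∣ ≡ ∣ x ∷ p ∣
    cons-cong true  = cong suc (∣reverse∣ p)
    cons-cong false = ∣reverse∣ p

lookup-ℵ : ∀ {n} (p : Subset n) j → lookup (ℵ p) j ≡ not (lookup p (opposite j))
lookup-ℵ p j = begin
  lookup (ℵ p) j                                  ≡⟨ cong (lookup (ℵ p)) (FinP.opposite-involutive j) ⟨
  lookup (ℵ p) (opposite (opposite j))            ≡⟨ lookup-reverse (∁ p) (opposite j) ⟩
  lookup (∁ p) (opposite j)                       ≡⟨ VecP.lookup-map (opposite j) not p ⟩
  not (lookup p (opposite j))                     ∎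

ℵ-involutive : ∀ {n} (p : Subset n) → ℵ (ℵ p) ≡ p
ℵ-involutive p = lookup-ext λ j → begin
  lookup (ℵ (ℵ p)) j                      ≡⟨ lookup-ℵ (ℵ p) j ⟩
  not (lookup (ℵ p) (opposite j))         ≡⟨ cong not (lookup-ℵ p (opposite j)) ⟩
  not (not (lookup p (opposite (opposite j))))
                                          ≡⟨ BoolP.not-involutive _ ⟩
  lookup p (opposite (opposite j))        ≡⟨ cong (lookup p) (FinP.opposite-involutive j) ⟩
  lookup p j                              ∎

∣ℵ∣ : ∀ {n} (p : Subset n) → ∣ ℵ p ∣ ≡ n ∸ ∣ p ∣
∣ℵ∣ p = trans (∣reverse∣ (∁ p)) (∣∁p∣≡n∸∣p∣ p)

ℵ-antitone : ∀ {n} {C C' : Subset n} → C ⊆ C' → ℵ C' ⊆ ℵ C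
ℵ-antitone {C = C} {C'} C⊆C' {x} x∈ℵC' = VecP.lookup⇒[]= x (ℵ C) (begin
    lookup (ℵ C) x               ≡⟨ lookup-ℵ C x ⟩
    not (lookup C (opposite x))  ≡⟨ cong not (∉⇒lookup≡false (λ x̄∈C → x̄∉C' (C⊆C' x̄∈C))) ⟩
    true                         ∎)
  where
    x̄∉C' : opposite x ∉ C'
    x̄∉C' x̄∈C' = true≢false (begin
      true                          ≡⟨ VecP.[]=⇒lookup x∈ℵC' ⟨
      lookup (ℵ C') x               ≡⟨ lookup-ℵ C' x ⟩
      not (lookup C' (opposite x))  ≡⟨ cong not (VecP.[]=⇒lookup x̄∈C') ⟩
      false                         ∎)

ℵ-edge : ∀ {n k} → n ≡ suc (k ℕ.+ k) → {C C' : Subset n} → Edge k C C' → Edge k (ℵ C') (ℵ C)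
ℵ-edge {n} {k} refl {C} {C'} (∣C∣≡k , ∣C'∣≡1+k , C⊆C') =
    trans (∣ℵ∣ C') (trans (cong (n ∸_) ∣C'∣≡1+k) (ℕP.m+n∸m≡n k k))
  , trans (∣ℵ∣ C) (trans (cong (n ∸_) ∣C∣≡k) (ℕP.m+n∸n≡m (suc k) k))
  , ℵ-antitone C⊆C'

skew-edge-pairing : ∀ {n k} → n ≡ suc (k ℕ.+ k) → (B B' : Subset n) → SkewEdge k B B' →
  SkewEdge k (ℵ⁻¹ B') (ℵ B) × ¬ ((ℵ⁻¹ B' ≡ B) × (ℵ B ≡ B'))
skew-edge-pairing n≡ B B' (edge , B'≢ℵB) =
  (ℵ-edge n≡ edge , λ ℵB≡ℵℵB' → B'≢ℵB (sym (trans ℵB≡ℵℵB' (ℵ-involutive B'))))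
  , λ (_ , ℵB≡B') → B'≢ℵB (sym ℵB≡B')

length≤2 : ∀ {A : Set} {P : A → Set} (xs : List A) → Unique xs → All P xs →
  (∀ {a b c} → P a → P b → P c → a ≢ b → b ≢ c → a ≢ c → ⊥) → length xs ≤ 2
length≤2 []              _ _ _ = z≤n
length≤2 (_ ∷ [])        _ _ _ = s≤s z≤n
length≤2 (_ ∷ _ ∷ [])    _ _ _ = s≤s (s≤s z≤n)
length≤2 (_ ∷ _ ∷ _ ∷ _) ((a≢b ∷ a≢c ∷ _) ∷ (b≢c ∷ _) ∷ _) (Pa ∷ Pb ∷ Pc ∷ _) no-three =
  ⊥-elim (no-three Pa Pb Pc a≢b b≢c a≢c)

-- Strings of length n = m+1 as n-periodic functions on ℤ.
module Cyclic (m : ℕ) where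

  open import Data.Integer using (ℤ; +_; _+_; _-_; _*_; -_; 0ℤ; 1ℤ; -1ℤ)
  import Data.Integer.Properties as ℤP
  open import Data.Integer.DivMod using (_%ℕ_; _/ℕ_; n%ℕd<d; a≡a%ℕn+[a/ℕn]*n)
  open import Data.Integer.Divisibility.Signed using (_∣_; divides; ∣⇒∣ᵤ; ∣m∣n⇒∣m+n; ∣n⇒∣m*n; _∣?_)
  open import Data.Integer.Tactic.RingSolver using (solve-∀)

  private
    n : ℕ
    n = suc m

  N : ℤ
  N = + n

  N≡m+1 : N ≡ + m + 1ℤ
  N≡m+1 = trans (cong +_ (ℕP.+-comm 1 m)) (ℤP.pos-+ m 1)

  infix 4 _≈_
  record _≈_ (x y : ℤ) : Set where
    constructor mk≈
    field n∣x-y : N ∣ (x - y)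
  open _≈_

  ≈-scale : ∀ {x y a b} c → x ≈ y → a - b ≡ c * (x - y) → a ≈ b
  ≈-scale c (mk≈ n∣) eq = mk≈ (subst (N ∣_) (sym eq) (∣n⇒∣m*n c n∣))

  ≈-add : ∀ {x y u v a b} → x ≈ y → u ≈ v → a - b ≡ (x - y) + (u - v) → a ≈ b
  ≈-add (mk≈ n∣₁) (mk≈ n∣₂) eq = mk≈ (subst (N ∣_) (sym eq) (∣m∣n⇒∣m+n n∣₁ n∣₂))

  ≈-multiple : ∀ {a b} q → a - b ≡ q * N → a ≈ b
  ≈-multiple q eq = mk≈ (divides q eq)

  ≈-reflexive : ∀ {x y} → x ≡ y → x ≈ y
  ≈-reflexive {x} refl = ≈-multiple 0ℤ (x-x≡0 x N)
    where x-x≡0 : ∀ x N → x - x ≡ 0ℤ * N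
          x-x≡0 = solve-∀

  ≈-refl : ∀ {x} → x ≈ x
  ≈-refl = ≈-reflexive refl

  ≈-sym : ∀ {x y} → x ≈ y → y ≈ x
  ≈-sym {x} {y} h = ≈-scale -1ℤ h (ring x y)
    where ring : ∀ x y → y - x ≡ -1ℤ * (x - y)
          ring = solve-∀

  ≈-trans : ∀ {x y z} → x ≈ y → y ≈ z → x ≈ z
  ≈-trans {x} {y} {z} h₁ h₂ = ≈-add h₁ h₂ (ring x y z)
    where ring : ∀ x y z → x - z ≡ (x - y) + (y - z)
          ring = solve-∀

  _≈?_ : ∀ x y → Dec (x ≈ y)
  x ≈? y with N ∣? (x - y)
  ... | yes n∣ = yes (mk≈ n∣)
  ... | no ¬n∣ = no λ h → ¬n∣ (n∣x-y h)

  m*t≈-t : ∀ t → + (m ℕ.* t) ≈ - + t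
  m*t≈-t t = ≈-multiple (+ t) (begin
    + (m ℕ.* t) - - + t  ≡⟨ cong (λ w → w - - + t) (ℤP.pos-* m t) ⟩
    + m * + t - - + t    ≡⟨ ring (+ m) (+ t) ⟩
    + t * (+ m + 1ℤ)     ≡⟨ cong (+ t *_) N≡m+1 ⟨
    + t * N              ∎)
    where ring : ∀ M T → M * T - - T ≡ T * (M + 1ℤ)
          ring = solve-∀

  -- Doubling is injective modulo n; this is where n odd is used.
  DoublingInjective : Set
  DoublingInjective = ∀ x → x + x ≈ 0ℤ → x ≈ 0ℤ

  -- For n = 2k+1 this holds because x = (k+1)·2x - x·n.
  odd⇒doubling-injective : ∀ {k} → m ≡ k ℕ.+ k → DoublingInjective
  odd⇒doubling-injective {k} m≡k+k x 2x≈0 = ≈-add [k+1]2x≈0 0≈x*N (ring₃ K x)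
    where
      K = + k
      N≡2K+1 : N ≡ K + K + 1ℤ
      N≡2K+1 = trans N≡m+1 (cong (_+ 1ℤ) (trans (cong +_ m≡k+k) (ℤP.pos-+ k k)))
      ring₁ : ∀ K x → (K + 1ℤ) * (x + x) - 0ℤ ≡ (K + 1ℤ) * ((x + x) - 0ℤ)
      ring₁ = solve-∀
      ring₂ : ∀ x M → 0ℤ - x * M ≡ (- x) * M
      ring₂ = solve-∀
      ring₃ : ∀ K x → x - 0ℤ ≡ ((K + 1ℤ) * (x + x) - 0ℤ) + (0ℤ - x * (K + K + 1ℤ))
      ring₃ = solve-∀
      [k+1]2x≈0 : (K + 1ℤ) * (x + x) ≈ 0ℤ
      [k+1]2x≈0 = ≈-scale (K + 1ℤ) 2x≈0 (ring₁ K x)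
      0≈x*N : 0ℤ ≈ x * (K + K + 1ℤ)
      0≈x*N = ≈-multiple (- x) (trans (ring₂ x (K + K + 1ℤ)) (cong ((- x) *_) (sym N≡2K+1)))

  ≈-below-n : ∀ {a b} → a ≤ b → b ℕ.< n → + a ≈ + b → a ≡ b
  ≈-below-n {a} {b} a≤b b<n (mk≈ n∣a-b) with b ∸ a in b-a≡
  ... | zero  = ℕP.≤-antisym a≤b (ℕP.m∸n≡0⇒m≤n b-a≡)
  ... | suc d = ⊥-elim (ℕD.>⇒∤ d<n n∣d)
    where
      n∣d : n ℕD.∣ suc d
      n∣d = subst (n ℕD.∣_)
        (trans (cong Data.Integer.∣_∣ (ℤP.m-n≡m⊖n a b)) (trans (ℤP.∣⊖∣-≤ a≤b) b-a≡)) (∣⇒∣ᵤ n∣a-b)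
      d<n : n ℕ.> suc d
      d<n = subst (ℕ._< n) b-a≡ (ℕP.≤-<-trans (ℕP.m∸n≤m b a) b<n)

  Fin-≈⇒≡ : ∀ (i j : Fin n) → + toℕ i ≈ + toℕ j → i ≡ j
  Fin-≈⇒≡ i j h with ℕP.≤-total (toℕ i) (toℕ j)
  ... | inj₁ i≤j = FinP.toℕ-injective (≈-below-n i≤j (FinP.toℕ<n j) h)
  ... | inj₂ j≤i = FinP.toℕ-injective (sym (≈-below-n j≤i (FinP.toℕ<n i) (≈-sym h)))

  -- The residue of z modulo n, as a position in a string of length n. It is kept
  -- opaque: only residue-≈ needs its definition.
  opaque
    residue : ℤ → Fin n
    residue z = fromℕ< (n%ℕd<d z n)

    residue-≈ : ∀ z → z ≈ + toℕ (residue z)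
    residue-≈ z = ≈-multiple (z /ℕ n) (begin
      z - + toℕ (residue z)         ≡⟨ cong (λ r → z - + r) (FinP.toℕ-fromℕ< (n%ℕd<d z n)) ⟩
      z - + (z %ℕ n)                ≡⟨ cong (_- + (z %ℕ n)) (a≡a%ℕn+[a/ℕn]*n z n) ⟩
      (+ (z %ℕ n) + z /ℕ n * N) - + (z %ℕ n)
                                    ≡⟨ ring (+ (z %ℕ n)) (z /ℕ n * N) ⟩
      z /ℕ n * N                    ∎)
      where ring : ∀ r t → (r + t) - r ≡ t
            ring = solve-∀

  residue-unique : ∀ z j → z ≈ + toℕ j → residue z ≡ j
  residue-unique z j h = Fin-≈⇒≡ (residue z) j (≈-trans (≈-sym (residue-≈ z)) h)

  at : Subset n → ℤ → Bool
  at p z = lookup p (residue z)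

  at-resp : ∀ p {z z'} → z ≈ z' → at p z ≡ at p z'
  at-resp p {z} {z'} h = cong (lookup p) (residue-unique z (residue z') (≈-trans h (residue-≈ z')))

  at-lookup : ∀ p j → at p (+ toℕ j) ≡ lookup p j
  at-lookup p j = cong (lookup p) (residue-unique _ j ≈-refl)

  at-ext : ∀ {p q} → (∀ z → at p z ≡ at q z) → p ≡ q
  at-ext {p} {q} h = lookup-ext λ j → trans (sym (at-lookup p j)) (trans (h (+ toℕ j)) (at-lookup q j))

  at-∪ : ∀ p q z → at (p ∪ q) z ≡ at p z ∨ at q z
  at-∪ p q z = VecP.lookup-zipWith _∨_ (residue z) p q

  at-⁅⁆ : ∀ i z → z ≈ + toℕ i → at ⁅ i ⁆ z ≡ true
  at-⁅⁆ i z h rewrite residue-unique z i h = VecP.[]=⇒lookup (x∈⁅x⁆ i)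

  at-⁅⁆-≉ : ∀ i z → ¬ z ≈ + toℕ i → at ⁅ i ⁆ z ≡ false
  at-⁅⁆-≉ i z z≉i = ∉⇒lookup≡false λ r∈⁅i⁆ →
    z≉i (subst (λ j → z ≈ + toℕ j) (x∈⁅y⁆⇒x≡y i r∈⁅i⁆) (residue-≈ z))

  lookup-rot : ∀ (p : Subset n) j → lookup (rot p) j ≡ at p (+ toℕ j + 1ℤ)
  lookup-rot (x ∷ p) j with last-or-inject₁ j
  ... | inj₁ refl =
    trans (lookup-∷ʳ-fromℕ p x) (sym (cong (lookup (x ∷ p)) (residue-unique _ Fin.zero last+1≈0)))
    where
      ring : ∀ M → (M + 1ℤ) - 0ℤ ≡ 1ℤ * (M + 1ℤ)
      ring = solve-∀
      last+1≈0 : + toℕ (fromℕ m) + 1ℤ ≈ 0ℤ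
      last+1≈0 rewrite FinP.toℕ-fromℕ m = ≈-multiple 1ℤ (trans (ring (+ m)) (cong (1ℤ *_) (sym N≡m+1)))
  ... | inj₂ (j' , refl) =
    trans (lookup-∷ʳ-inject₁ p x j') (sym (cong (lookup (x ∷ p)) (residue-unique _ (Fin.suc j') j'+1≈)))
    where
      j'+1≈ : + toℕ (inject₁ j') + 1ℤ ≈ + suc (toℕ j')
      j'+1≈ rewrite FinP.toℕ-inject₁ j' =
        ≈-reflexive (trans (ℤP.+-comm (+ toℕ j') 1ℤ) (sym (ℤP.pos-+ 1 (toℕ j'))))

  at-rot : ∀ p z → at (rot p) z ≡ at p (z + 1ℤ)
  at-rot p z = trans (lookup-rot p (residue z))
                     (at-resp p (≈-scale 1ℤ (≈-sym (residue-≈ z)) (ring (+ toℕ (residue z)) z)))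
    where ring : ∀ r z → (r + 1ℤ) - (z + 1ℤ) ≡ 1ℤ * (r - z)
          ring = solve-∀

  at-shift : ∀ t p z → at (shift t p) z ≡ at p (z + + t)
  at-shift zero    p z = at-resp p (≈-reflexive (sym (ℤP.+-identityʳ z)))
  at-shift (suc t) p z = begin
    at (rot (shift t p)) z   ≡⟨ at-rot (shift t p) z ⟩
    at (shift t p) (z + 1ℤ)  ≡⟨ at-shift t p (z + 1ℤ) ⟩
    at p (z + 1ℤ + + t)      ≡⟨ cong (at p) (ring z (+ t)) ⟩
    at p (z + (1ℤ + + t))    ≡⟨ cong (λ w → at p (z + w)) (ℤP.pos-+ 1 t) ⟨
    at p (z + + suc t)       ∎
    where ring : ∀ z t → z + 1ℤ + t ≡ z + (1ℤ + t)
          ring = solve-∀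

  at-ℵ : ∀ p z → at (ℵ p) z ≡ not (at p (-1ℤ - z))
  at-ℵ p z = trans (lookup-ℵ p r)
                   (cong (λ j → not (lookup p j)) (sym (residue-unique (-1ℤ - z) (opposite r) reflected)))
    where
      r = residue z
      t = toℕ r
      opposite≡ : + toℕ (opposite r) ≡ + m - + t
      opposite≡ = trans (cong +_ (FinP.opposite-prop r))
                        (trans (sym (ℤP.⊖-≥ (ℕP.≤-pred (FinP.toℕ<n r)))) (sym (ℤP.m-n≡m⊖n m t)))
      ring₁ : ∀ z t → (-1ℤ - z) - (-1ℤ - t) ≡ -1ℤ * (z - t)
      ring₁ = solve-∀
      ring₂ : ∀ t M → (-1ℤ - t) - (M - t) ≡ -1ℤ * (M + 1ℤ)
      ring₂ = solve-∀
      reflected : -1ℤ - z ≈ + toℕ (opposite r)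
      reflected = subst (-1ℤ - z ≈_) (sym opposite≡)
        (≈-trans (≈-scale -1ℤ (residue-≈ z) (ring₁ z (+ t)))
                 (≈-multiple -1ℤ (trans (ring₂ (+ t) (+ m)) (cong (-1ℤ *_) (sym N≡m+1)))))

  shift-∼π : ∀ t {p q : Subset n} → shift t p ≡ q → p ∼π q
  shift-∼π t {p} shift≡ = residue (+ t) , trans (at-ext λ z → begin
      at (shift (toℕ (residue (+ t))) p) z  ≡⟨ at-shift _ p z ⟩
      at p (z + r)                          ≡⟨ at-resp p (≈-scale 1ℤ (≈-sym (residue-≈ (+ t))) (ring z r (+ t))) ⟩
      at p (z + + t)                        ≡⟨ at-shift t p z ⟨
      at (shift t p) z                      ∎) shift≡
    where
      r = + toℕ (residue (+ t))
      ring : ∀ z r t → (z + r) - (z + t) ≡ 1ℤ * (r - t)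
      ring = solve-∀

  -- Translation by m·t = -t (mod n) undoes translation by t.
  shift-inverse : ∀ t p → shift (m ℕ.* t) (shift t p) ≡ p
  shift-inverse t p = at-ext λ z → begin
    at (shift (m ℕ.* t) (shift t p)) z  ≡⟨ at-shift (m ℕ.* t) (shift t p) z ⟩
    at (shift t p) (z + + (m ℕ.* t))    ≡⟨ at-shift t p _ ⟩
    at p (z + + (m ℕ.* t) + + t)        ≡⟨ at-resp p (≈-scale 1ℤ (m*t≈-t t) (ring z (+ (m ℕ.* t)) (+ t))) ⟩
    at p z                              ∎
    where ring : ∀ z s t → (z + s + t) - z ≡ 1ℤ * (s - - t)
          ring = solve-∀

  ℵ-shift : ∀ t p → ℵ (shift t p) ≡ shift (m ℕ.* t) (ℵ p)
  ℵ-shift t p = at-ext λ z → begin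
    at (ℵ (shift t p)) z                   ≡⟨ at-ℵ (shift t p) z ⟩
    not (at (shift t p) (-1ℤ - z))         ≡⟨ cong not (at-shift t p (-1ℤ - z)) ⟩
    not (at p (-1ℤ - z + + t))             ≡⟨ cong not (at-resp p (≈-scale 1ℤ (m*t≈-t t) (ring z _ (+ t)))) ⟩
    not (at p (-1ℤ - (z + + (m ℕ.* t))))   ≡⟨ at-ℵ p _ ⟨
    at (ℵ p) (z + + (m ℕ.* t))             ≡⟨ at-shift (m ℕ.* t) (ℵ p) z ⟨
    at (shift (m ℕ.* t) (ℵ p)) z           ∎
    where ring : ∀ z s t → (-1ℤ - z + t) - (-1ℤ - (z + s)) ≡ 1ℤ * (s - - t)
          ring = solve-∀

  -- Consequently π is symmetric and ℵ respects it, so ℵ_π is well defined.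
  ∼π-sym : ∀ {p q : Subset n} → p ∼π q → q ∼π p
  ∼π-sym {p} (i , shift≡) = shift-∼π (m ℕ.* toℕ i) (begin
    shift (m ℕ.* toℕ i) _                ≡⟨ cong (shift (m ℕ.* toℕ i)) shift≡ ⟨
    shift (m ℕ.* toℕ i) (shift (toℕ i) p) ≡⟨ shift-inverse (toℕ i) p ⟩
    p                                    ∎)

  ℵ-∼π : ∀ {p q : Subset n} → p ∼π q → ℵ p ∼π ℵ q
  ℵ-∼π {p} (i , shift≡) = shift-∼π (m ℕ.* toℕ i) (trans (sym (ℵ-shift (toℕ i) p)) (cong ℵ shift≡))

  AntiSymmetricAbout : (ℤ → Bool) → ℤ → Set
  AntiSymmetricAbout b c = ∀ y z → y + z ≈ c + c → ¬ y ≈ c → b y ≡ not (b z)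

  IsCentre : (ℤ → Bool) → ℤ → Set
  IsCentre b c = b c ≡ false × AntiSymmetricAbout b c

  -- Reflecting a zero r ≢ c of b about c gives a one, and reflecting that about d
  -- gives the zero r + 2d - 2c, unless the one lies at d (i.e. r + d ≡ 2c).
  double-reflection : ∀ b {c d r} → AntiSymmetricAbout b c → AntiSymmetricAbout b d →
    b r ≡ false → ¬ r ≈ c → ¬ (r + d) ≈ (c + c) → b (r + (d + d) - (c + c)) ≡ false
  double-reflection b {c} {d} {r} sym-c sym-d br r≉c r+d≉2c = begin
    b s            ≡⟨ not-swap (sym-d u s (≈-reflexive (ring-us r c d)) u≉d) ⟩
    not (b u)      ≡⟨ cong not bu ⟩
    false          ∎
    where
      u = (c + c) - r
      s = r + (d + d) - (c + c)
      ring-ru : ∀ r c → r + ((c + c) - r) ≡ c + c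
      ring-ru = solve-∀
      ring-us : ∀ r c d → ((c + c) - r) + (r + (d + d) - (c + c)) ≡ d + d
      ring-us = solve-∀
      ring-ud : ∀ r c d → (r + d) - (c + c) ≡ -1ℤ * (((c + c) - r) - d)
      ring-ud = solve-∀
      bu : b u ≡ true
      bu = trans (not-swap (sym-c r u (≈-reflexive (ring-ru r c)) r≉c)) (cong not br)
      u≉d : ¬ u ≈ d
      u≉d u≈d = r+d≉2c (≈-scale -1ℤ u≈d (ring-ud r c d))

  -- If r is the mirror image of p about q (or of q about p), then b r = ¬ b p = 1.
  -- Otherwise the two double reflections of r give zeros s, t with s + t = 2r and
  -- s - r = 2(p - q) ≢ 0, contradicting anti-symmetry about r.
  no-three-centres : DoublingInjective → ∀ b {p q r} →
    IsCentre b p → IsCentre b q → IsCentre b r → ¬ p ≈ q → ¬ q ≈ r → ¬ p ≈ r → ⊥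
  no-three-centres double-inj b {p} {q} {r} (bp , sym-p) (bq , sym-q) (br , sym-r) p≉q q≉r p≉r
    with (r + p) ≈? (q + q) | (r + q) ≈? (p + p)
  ... | yes r+p≈2q | _ = true≢false (trans (sym (trans (sym-q r p r+p≈2q r≉q) (cong not bp))) br)
    where r≉q = λ r≈q → q≉r (≈-sym r≈q)
  ... | no _ | yes r+q≈2p = true≢false (trans (sym (trans (sym-p r q r+q≈2p r≉p) (cong not bq))) br)
    where r≉p = λ r≈p → p≉r (≈-sym r≈p)
  ... | no r+p≉2q | no r+q≉2p = true≢false (sym (begin
      false      ≡⟨ double-reflection b sym-q sym-p br (λ r≈q → q≉r (≈-sym r≈q)) r+p≉2q ⟨
      b s        ≡⟨ sym-r s t (≈-reflexive (ring-st r p q)) s≉r ⟩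
      not (b t)  ≡⟨ cong not (double-reflection b sym-p sym-q br (λ r≈p → p≉r (≈-sym r≈p)) r+q≉2p) ⟩
      true       ∎))
    where
      s = r + (p + p) - (q + q)
      t = r + (q + q) - (p + p)
      ring-st : ∀ r p q → (r + (p + p) - (q + q)) + (r + (q + q) - (p + p)) ≡ r + r
      ring-st = solve-∀
      ring-2d : ∀ r p q → ((p - q) + (p - q)) - 0ℤ ≡ 1ℤ * ((r + (p + p) - (q + q)) - r)
      ring-2d = solve-∀
      ring-d : ∀ p q → p - q ≡ 1ℤ * ((p - q) - 0ℤ)
      ring-d = solve-∀
      s≉r : ¬ s ≈ r
      s≉r s≈r = p≉q (≈-scale 1ℤ (double-inj (p - q) (≈-scale 1ℤ s≈r (ring-2d r p q))) (ring-d p q))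

  Horizontal : Subset n → Fin n → Set
  Horizontal A i = i ∉ A × (A ∪ ⁅ i ⁆) ∼π ℵ A

  -- A horizontal edge says that A ∪ {i} is a translate of ℵ A, i.e. a reflection of
  -- the complement of A.
  horizontal⇒reflection : ∀ A i → Horizontal A i →
    Σ ℤ λ c → ∀ w → at A w ∨ at ⁅ i ⁆ w ≡ not (at A (c - w))
  horizontal⇒reflection A i (_ , t , shift≡) = T - 1ℤ , λ w → begin
    at A w ∨ at ⁅ i ⁆ w                     ≡⟨ at-∪ A ⁅ i ⁆ w ⟨
    at (A ∪ ⁅ i ⁆) w                        ≡⟨ cong (at (A ∪ ⁅ i ⁆)) (ring₁ w T) ⟩
    at (A ∪ ⁅ i ⁆) (w - T + T)              ≡⟨ at-shift (toℕ t) (A ∪ ⁅ i ⁆) (w - T) ⟨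
    at (shift (toℕ t) (A ∪ ⁅ i ⁆)) (w - T)  ≡⟨ cong (λ q → at q (w - T)) shift≡ ⟩
    at (ℵ A) (w - T)                        ≡⟨ at-ℵ A (w - T) ⟩
    not (at A (-1ℤ - (w - T)))              ≡⟨ cong (λ x → not (at A x)) (ring₂ w T) ⟩
    not (at A (T - 1ℤ - w))                 ∎
    where
      T = + toℕ t
      ring₁ : ∀ w T → w ≡ w - T + T
      ring₁ = solve-∀
      ring₂ : ∀ w T → -1ℤ - (w - T) ≡ T - 1ℤ - w
      ring₂ = solve-∀

  -- A reflection symmetry c - w of this kind with i ∉ A must fix i, so i is a centre of A.
  reflection⇒centre : ∀ A i c → i ∉ A → (∀ w → at A w ∨ at ⁅ i ⁆ w ≡ not (at A (c - w))) →
    IsCentre (at A) (+ toℕ i)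
  reflection⇒centre A i c i∉A symmetry = bI , anti-symmetric
    where
      I = + toℕ i
      bI : at A I ≡ false
      bI = trans (at-lookup A i) (∉⇒lookup≡false i∉A)
      off-i : ∀ w → ¬ w ≈ I → at A w ≡ not (at A (c - w))
      off-i w w≉I = trans (sym (BoolP.∨-identityʳ (at A w)))
                          (trans (cong (at A w ∨_) (sym (at-⁅⁆-≉ i w w≉I))) (symmetry w))
      b[c-I] : at A (c - I) ≡ false
      b[c-I] = not-swap (trans (sym (trans (cong (at A I ∨_) (at-⁅⁆ i I ≈-refl)) (BoolP.∨-zeroʳ (at A I))))
                               (symmetry I))
      ring-cc : ∀ c I → c - (c - I) ≡ I
      ring-cc = solve-∀
      c-I≈I : c - I ≈ I
      c-I≈I with (c - I) ≈? I
      ... | yes c-I≈I = c-I≈I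
      ... | no c-I≉I = ⊥-elim (true≢false (begin
            true                     ≡⟨ cong not bI ⟨
            not (at A I)             ≡⟨ cong (λ x → not (at A x)) (ring-cc c I) ⟨
            not (at A (c - (c - I))) ≡⟨ off-i (c - I) c-I≉I ⟨
            at A (c - I)             ≡⟨ b[c-I] ⟩
            false                    ∎))
      ring-yz : ∀ c I y z → (c - y) - z ≡ ((c - I) - I) + ((I + I) - (y + z))
      ring-yz = solve-∀
      anti-symmetric : AntiSymmetricAbout (at A) I
      anti-symmetric y z y+z≈2I y≉I =
        trans (off-i y y≉I) (cong not (at-resp A (≈-add c-I≈I (≈-sym y+z≈2I) (ring-yz c I y z))))

  horizontal-count : DoublingInjective → ∀ A → qEdgeCount A (ℵ A) ≤ 2
  horizontal-count double-inj A =
    length≤2 _ (filter⁺ horizontal? (allFin⁺ n)) (all-filter horizontal? (allFin n)) no-three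
    where
      horizontal? = λ i → ¬? (i ∈? A) ×-dec ((A ∪ ⁅ i ⁆) ∼π? ℵ A)
      centre : ∀ {i} → Horizontal A i → IsCentre (at A) (+ toℕ i)
      centre {i} h with horizontal⇒reflection A i h
      ... | c , symmetry = reflection⇒centre A i c (proj₁ h) symmetry
      distinct : ∀ {i j : Fin n} → i ≢ j → ¬ + toℕ i ≈ + toℕ j
      distinct i≢j h = i≢j (Fin-≈⇒≡ _ _ h)
      no-three : ∀ {i j l} → Horizontal A i → Horizontal A j → Horizontal A l → i ≢ j → j ≢ l → i ≢ l → ⊥
      no-three hi hj hl i≢j j≢l i≢l = no-three-centres double-inj (at A) (centre hi) (centre hj) (centre hl)
        (distinct i≢j) (distinct j≢l) (distinct i≢l)

  quotient-skew-pairing : ∀ {k} → m ≡ k ℕ.+ k → (A A' : Subset n) → QSkewEdge k A A' →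
    QSkewEdge k (ℵ⁻¹ A') (ℵ A)
  quotient-skew-pairing m≡k+k A A' (C , C' , C∼A , C'∼A' , edge , A'≁ℵA) =
    ℵ C' , ℵ C , ℵ-∼π C'∼A' , ℵ-∼π C∼A , ℵ-edge (cong suc m≡k+k) edge ,
    λ ℵA∼ℵℵA' → A'≁ℵA (∼π-sym (subst (ℵ A ∼π_) (ℵ-involutive A') ℵA∼ℵℵA'))

open import Data.Nat using (_+_; _*_)

theorem1 : (k : ℕ) → 1 ≤ k →
    -- (a) skew edges of M_k/π come in pairs
    ((A A' : Subset (2 * k + 1)) → InLevel k A → InLevel (suc k) A' →
      QSkewEdge k A A' → QSkewEdge k (ℵ⁻¹ A') (ℵ A))
    -- (i) skew edges of M_k come in pairs {B,B'}, {ℵ⁻¹(B'),ℵ(B)} (distinct)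
    × ((B B' : Subset (2 * k + 1)) → SkewEdge k B B' →
        SkewEdge k (ℵ⁻¹ B') (ℵ B) × ¬ ((ℵ⁻¹ B' ≡ B) × (ℵ B ≡ B')))
    -- (ii) at most 2 (horizontal) edges of M_k/π between u and ℵ_π(u)
    × ((A : Subset (2 * k + 1)) → InLevel k A → qEdgeCount A (ℵ A) ≤ 2)
theorem1 k _ rewrite ℕP.+-comm (2 * k) 1 =
    (λ A A' _ _ → quotient-skew-pairing double≡k+k A A')
  , skew-edge-pairing (cong suc double≡k+k)
  , (λ A _ → horizontal-count (odd⇒doubling-injective {k} double≡k+k) A)
  where
    open Cyclic (2 * k)
    double≡k+k : 2 * k ≡ k + k
    double≡k+k = cong (k +_) (ℕP.+-identityʳ k)
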